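{- Let $X$ be a finite set with $|X|\ge3$ and $c$ a partial choice function on pairs from $X$. If $c$ is chaotic, then $c$ is valence-imbalanced.
   Context: A partial choice function is a map $c$ from a set of 2-element subsets of $X$ with $c\{x,y\}\in\{x,y\}$. $W^x_y(c)$ is $1$ if $c\{x,y\}=x$, $-1$ if $c\{x,y\}=y$, $0$ if $\{x,y\}\notin\operatorname{dom}c$ (including $x=y$). $\operatorname{val}_c(x)=\sum_{y\in X}W^x_y(c)$; $c$ is balanced if all valences are $0$, imbalanced otherwise. $c$ is partisan if there is nonempty $W\subsetneq X$ with $c\{x,y\}=x\iff(x\in W\text{ and }y\notin W)$; $c$ is chaotic if it is imbalanced and not partisan. For $\ell\in\{ -1,0,1\}$, $V_\ell(c)=\{(\operatorname{val}_c(x)-\ell,\operatorname{val}_c(y)+\ell): x\neq y,\ W^x_y(c)=\ell\}$; $\operatorname{conv}$ is convex hull in $\mathbb{Q}\times\mathbb{Q}$. $c$ is valence-imbalanced if $(0,0)=r_{ -1}\bar v_{ -1}+r_0\bar v_0+r_1\bar v_1$ with $\bar v_\ell\in\operatorname{conv}(V_\ell(c))$, $r_\ell\in[0,1]\cap\mathbb{Q}$, $r_{ -1}+r_0+r_1=1$ and $r_{ -1}\neq r_1$, where a term whose coefficient $r_\ell$ is $0$ may be omitted (so $\bar v_\ell$ need not exist if $r_\ell=0$). -}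

module Defs where

open import Data.Nat as ℕ using (ℕ)
open import Data.Integer as ℤ using (ℤ; +_; -[1+_])
open import Data.Rational as ℚ using (ℚ; 0ℚ; 1ℚ)
open import Data.Fin using (Fin; _≟_)
open import Data.List using (List; []; _∷_; map; foldr; allFin)
open import Data.List.Relation.Unary.All using (All)
open import Data.Maybe using (Maybe; just; nothing)
open import Data.Bool using (Bool; true; false)
open import Data.Product using (Σ; ∃; _×_; _,_; proj₁; proj₂)
open import Data.Sum using (_⊎_)
open import Relation.Nullary using (¬_; yes; no)
open import Relation.Binary.PropositionalEquality using (_≡_; _≢_)
open import Function.Bundles using (_⇔_)

-- A partial choice function on the 2-element subsets of X = Fin n.
-- choose x y = nothing   : {x,y} ∉ dom c   (always the case for x = y)
-- choose x y = just z    : c{x,y} = z, with z ∈ {x,y}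
-- symmetry makes it a function of the unordered pair {x,y}.
record PartialChoice (n : ℕ) : Set where
  field
    choose  : Fin n → Fin n → Maybe (Fin n)
    sym     : ∀ x y → choose x y ≡ choose y x
    irrefl  : ∀ x → choose x x ≡ nothing
    member  : ∀ x y z → choose x y ≡ just z → z ≡ x ⊎ z ≡ y
open PartialChoice public

W : ∀ {n} → PartialChoice n → Fin n → Fin n → ℤ
W c x y with choose c x y
... | nothing = + 0
... | just z with z ≟ x
...   | yes _ = + 1
...   | no _  = -[1+ 0 ]

sumℤ : List ℤ → ℤ
sumℤ = foldr ℤ._+_ (+ 0)

val : ∀ {n} → PartialChoice n → Fin n → ℤ
val {n} c x = sumℤ (map (W c x) (allFin n))

Balanced : ∀ {n} → PartialChoice n → Set
Balanced c = ∀ x → val c x ≡ + 0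

Imbalanced : ∀ {n} → PartialChoice n → Set
Imbalanced c = ¬ Balanced c

Partisan : ∀ {n} → PartialChoice n → Set
Partisan {n} c = Σ (Fin n → Bool) λ S →
    (∃ λ x → S x ≡ true)
  × (∃ λ x → S x ≡ false)
  × (∀ x y → (choose c x y ≡ just x) ⇔ (S x ≡ true × S y ≡ false))

Chaotic : ∀ {n} → PartialChoice n → Set
Chaotic c = Imbalanced c × ¬ Partisan c

Pt : Set
Pt = ℚ × ℚ

toℚ : ℤ → ℚ
toℚ z = z ℚ./ 1

_+ᵖ_ : Pt → Pt → Pt
(a , b) +ᵖ (c , d) = (a ℚ.+ c , b ℚ.+ d)

_·ᵖ_ : ℚ → Pt → Pt
r ·ᵖ (a , b) = (r ℚ.* a , r ℚ.* b)

0ᵖ : Pt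
0ᵖ = (0ℚ , 0ℚ)

InV : ∀ {n} → PartialChoice n → ℤ → Pt → Set
InV {n} c ℓ p = Σ (Fin n) λ x → Σ (Fin n) λ y →
  x ≢ y × W c x y ≡ ℓ
  × p ≡ (toℚ (val c x ℤ.- ℓ) , toℚ (val c y ℤ.+ ℓ))

InConv : (Pt → Set) → Pt → Set
InConv P p = Σ (List (ℚ × Pt)) λ ws →
    All (λ wq → ℚ.0ℚ ℚ.≤ proj₁ wq × P (proj₂ wq)) ws
  × foldr (λ wq s → proj₁ wq ℚ.+ s) 0ℚ ws ≡ 1ℚ
  × foldr (λ wq s → (proj₁ wq ·ᵖ proj₂ wq) +ᵖ s) 0ᵖ ws ≡ p

InUnit : ℚ → Set
InUnit r = 0ℚ ℚ.≤ r × r ℚ.≤ 1ℚ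

-- r_ℓ v̄_ℓ term: either r_ℓ = 0 (term omitted, v̄_ℓ irrelevant) or v̄_ℓ ∈ conv V_ℓ
ValenceImbalanced : ∀ {n} → PartialChoice n → Set
ValenceImbalanced c =
  Σ ℚ λ rm → Σ ℚ λ r0 → Σ ℚ λ rp → Σ Pt λ vm → Σ Pt λ v0 → Σ Pt λ vp →
    InUnit rm × InUnit r0 × InUnit rp
  × rm ℚ.+ r0 ℚ.+ rp ≡ 1ℚ
  × rm ≢ rp
  × (rm ≡ 0ℚ ⊎ InConv (InV c -[1+ 0 ]) vm)
  × (r0 ≡ 0ℚ ⊎ InConv (InV c (+ 0)) v0)
  × (rp ≡ 0ℚ ⊎ InConv (InV c (+ 1)) vp)
  × (rm ·ᵖ vm) +ᵖ ((r0 ·ᵖ v0) +ᵖ (rp ·ᵖ vp)) ≡ 0ᵖ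

module Submission where

-- Write v(x) for the valence, N = |X|, S = Σ v(x)² and Q = Σ W(x,y)² (the number
-- of ordered pairs in dom c).  It suffices to find nonnegative integer weights
-- a(x,y) on the ordered pairs x ≠ y with
--     Σ a(x,y) · (v x − W(x,y) , v y + W(x,y)) = 0   and   Σ a(x,y) W(x,y) ≠ 0 :
-- grouping the pairs by ℓ = W(x,y) ∈ {−1,0,1} and normalising by the total
-- weight gives the convex combination with r₋₁ ≠ r₁.  We take
--     a = K + α W + β (v x − v y),   α = (N − 2) S,  β = Q − S,  K ≫ 0.
-- Every sum involved is bilinear in (1, W, v x, v y), hence determined by the
-- second moments of these functions (the Gram lemma ∑∑-gram): both coordinate
-- sums vanish and Σ a W = S (N Q − 2 S).  Here S ≠ 0 because c is imbalanced,
-- and N Q ≠ 2 S because Σ (N W − v x + v y)² = N (N Q − 2 S), so N Q = 2 S makes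
-- W additive along paths, which forces c to be partisan.

open import Data.Nat using (ℕ; zero; suc; z≤n; _≥_)
open import Data.Nat.Coprimality as C using (1-coprimeTo)
open import Data.Integer as ℤ
  using (ℤ; +_; -[1+_]; 0ℤ; 1ℤ; _+_; _*_; _-_; -_; _≤_; +≤+; ∣_∣; nonNegative)
open import Data.Integer.Properties
  using ( +-*-semiring; +-identityˡ; +-identityʳ; +-comm; +-assoc; +-inverseʳ; *-identityˡ
        ; *-identityʳ; *-zeroˡ; *-zeroʳ; *-comm; *-distribˡ-+; *-cancelˡ-≡; -1*i≡-i
        ; neg-distribˡ-*; pos-*; i*j≡0⇒i≡0∨j≡0; ≤-refl; ≤-trans; ≤-reflexive; ≤-antisym
        ; +-mono-≤; +-monoˡ-≤; i≤i+j; i≤j+i )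
open import Data.Integer.Tactic.RingSolver using (solve-∀)
open import Data.Rational as ℚ using (ℚ; mkℚ; 0ℚ; 1ℚ)
import Data.Rational.Properties as ℚP
open import Data.Rational.Solver using (module +-*-Solver)
open +-*-Solver using (solve; _:+_; _:*_; _:=_)
open import Data.Bool using (Bool; true; false; not; _∧_)
open import Data.Fin using (Fin; zero; suc; _≟_)
open import Data.Fin.Properties using (¬∀⟶∃¬)
open import Data.List using (List; []; _∷_; _++_; map; foldr; concat; filter; tabulate; allFin)
open import Data.List.Properties using (map-tabulate)
open import Data.List.Relation.Unary.All as All using (All; []; _∷_)
open import Data.List.Relation.Unary.All.Properties using (all-filter)
open import Data.Maybe using (just; nothing)
open import Data.Product using (Σ; ∃; _×_; _,_; proj₁; proj₂)
open import Data.Sum using (_⊎_; inj₁; inj₂)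
open import Data.Empty using (⊥; ⊥-elim)
open import Relation.Nullary using (Dec; yes; no; does)
open import Relation.Nullary.Decidable using (dec-true; dec-false; ¬?; _×-dec_)
open import Relation.Binary.PropositionalEquality
open import Function.Bundles using (mk⇔)
open import Algebra.Properties.Semiring.Sum +-*-semiring
  using (sum; sum-syntax; sum-cong-≗; ∑-distrib-+; ∑-comm; *-distribˡ-sum; *-distribʳ-sum; sum-replicate-zero)

open import Defs renaming (sym to choose-sym)

self-neg⇒0 : ∀ a → a ≡ - a → a ≡ 0ℤ
self-neg⇒0 (+ zero)  _  = refl
self-neg⇒0 (+ suc m) ()
self-neg⇒0 -[1+ m ]  ()

parts≤sum₃ : ∀ {a b d} → 0ℤ ≤ a → 0ℤ ≤ b → 0ℤ ≤ d →
  a ≤ a + b + d × b ≤ a + b + d × d ≤ a + b + d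
parts≤sum₃ {a} {b} {d} a≥0 b≥0 d≥0 =
  ≤-trans (i≤i+j a b {{nonNegative b≥0}}) (i≤i+j (a + b) d {{nonNegative d≥0}}) ,
  ≤-trans (i≤j+i b a {{nonNegative a≥0}}) (i≤i+j (a + b) d {{nonNegative d≥0}}) ,
  i≤j+i d (a + b) {{nonNegative (+-mono-≤ a≥0 b≥0)}}

square≥0 : ∀ a → 0ℤ ≤ a * a
square≥0 (+ m)     = subst (0ℤ ≤_) (pos-* m m) (+≤+ z≤n)
square≥0 -[1+ m ]  = +≤+ z≤n

square≡0⇒0 : ∀ {a} → a * a ≡ 0ℤ → a ≡ 0ℤ
square≡0⇒0 {a} a²≡0 with i*j≡0⇒i≡0∨j≡0 a a²≡0
... | inj₁ a≡0 = a≡0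
... | inj₂ a≡0 = a≡0

∣i∣+i≥0 : ∀ i → 0ℤ ≤ + ∣ i ∣ + i
∣i∣+i≥0 (+ m)    = +≤+ z≤n
∣i∣+i≥0 -[1+ m ] = ≤-reflexive (sym (+-inverseʳ (+ suc m)))

ℓ₋ ℓ₀ ℓ₊ : ℤ
ℓ₋ = -[1+ 0 ]
ℓ₀ = 0ℤ
ℓ₊ = 1ℤ

Trit Bit : ℤ → Set
Trit a = a ≡ ℓ₋ ⊎ a ≡ ℓ₀ ⊎ a ≡ ℓ₊
Bit  a = a ≡ 0ℤ ⊎ a ≡ 1ℤ

trit-successor : ∀ {a b} → Trit a → Trit b → a + 1ℤ ≡ b → Bit b
trit-successor _                (inj₂ b-bit) _  = b-bit
trit-successor (inj₁ refl)       (inj₁ refl)    ()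
trit-successor (inj₂ (inj₁ refl)) (inj₁ refl)   ()
trit-successor (inj₂ (inj₂ refl)) (inj₁ refl)   ()

bit-difference : ∀ {a b} → Bit a → Bit b → a + - b ≡ 1ℤ → a ≡ 1ℤ × b ≡ 0ℤ
bit-difference (inj₂ refl) (inj₁ refl) _  = refl , refl
bit-difference (inj₁ refl) (inj₁ refl) ()
bit-difference (inj₁ refl) (inj₂ refl) ()
bit-difference (inj₂ refl) (inj₂ refl) ()

zero-or-suc : ∀ z → 0ℤ ≤ z → z ≡ 0ℤ ⊎ ∃ λ k → z ≡ + suc k
zero-or-suc (+ zero)  _ = inj₁ refl
zero-or-suc (+ suc k) _ = inj₂ (k , refl)

𝟙 : Bool → ℤ
𝟙 true  = 1ℤ
𝟙 false = 0ℤ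

off : ∀ {n} → Fin n → Fin n → ℤ
off x y = 𝟙 (not (does (x ≟ y)))

split-by-value : ∀ b {w} → Trit w → (h : ℤ → ℤ) →
  𝟙 (b ∧ does (w ℤ.≟ ℓ₋)) * h ℓ₋ + 𝟙 (b ∧ does (w ℤ.≟ ℓ₀)) * h ℓ₀
  + 𝟙 (b ∧ does (w ℤ.≟ ℓ₊)) * h ℓ₊ ≡ 𝟙 b * h w
split-by-value false {w} _          h = none (h ℓ₋) (h ℓ₀) (h ℓ₊) (h w)
  where none : ∀ a b d e → 0ℤ * a + 0ℤ * b + 0ℤ * d ≡ 0ℤ * e
        none = solve-∀
split-by-value true (inj₁ refl)        h = first (h ℓ₋) (h ℓ₀) (h ℓ₊)
  where first : ∀ a b d → 1ℤ * a + 0ℤ * b + 0ℤ * d ≡ 1ℤ * a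
        first = solve-∀
split-by-value true (inj₂ (inj₁ refl)) h = second (h ℓ₋) (h ℓ₀) (h ℓ₊)
  where second : ∀ a b d → 0ℤ * a + 1ℤ * b + 0ℤ * d ≡ 1ℤ * b
        second = solve-∀
split-by-value true (inj₂ (inj₂ refl)) h = third (h ℓ₋) (h ℓ₀) (h ℓ₊)
  where third : ∀ a b d → 0ℤ * a + 0ℤ * b + 1ℤ * d ≡ 1ℤ * d
        third = solve-∀

∑-zero : ∀ n → ∑[ i < n ] 0ℤ ≡ 0ℤ
∑-zero n = sum-replicate-zero n

∑-scale : ∀ {n} (k : ℤ) (f : Fin n → ℤ) → ∑[ i < n ] (k * f i) ≡ k * sum f
∑-scale k f = sym (*-distribˡ-sum k f)

∑-const : ∀ n (k : ℤ) → ∑[ i < n ] k ≡ + n * k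
∑-const zero    k = sym (*-zeroˡ k)
∑-const (suc n) k = trans (cong (λ s → k + s) (∑-const n k)) (step k (+ n))
  where step : ∀ k m → k + m * k ≡ (1ℤ + m) * k
        step = solve-∀

∑-nonneg : ∀ {n} (f : Fin n → ℤ) → (∀ i → 0ℤ ≤ f i) → 0ℤ ≤ sum f
∑-nonneg {zero}  f f≥0 = ≤-refl
∑-nonneg {suc n} f f≥0 = +-mono-≤ (f≥0 zero) (∑-nonneg (λ i → f (suc i)) (λ i → f≥0 (suc i)))

∑-term≤ : ∀ {n} (f : Fin n → ℤ) → (∀ i → 0ℤ ≤ f i) → ∀ i → f i ≤ sum f
∑-term≤ f f≥0 zero    = i≤i+j _ _ {{nonNegative (∑-nonneg _ (λ i → f≥0 (suc i)))}}
∑-term≤ f f≥0 (suc i) = ≤-trans (∑-term≤ (λ j → f (suc j)) (λ j → f≥0 (suc j)) i)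
  (subst (sum (λ j → f (suc j)) ≤_) (+-comm (sum (λ j → f (suc j))) (f zero))
     (i≤i+j _ _ {{nonNegative (f≥0 zero)}}))

∑-zero⇒terms-zero : ∀ {n} (f : Fin n → ℤ) → (∀ i → 0ℤ ≤ f i) → sum f ≡ 0ℤ → ∀ i → f i ≡ 0ℤ
∑-zero⇒terms-zero f f≥0 ∑f≡0 i =
  ≤-antisym (≤-trans (∑-term≤ f f≥0 i) (≤-reflexive ∑f≡0)) (f≥0 i)

∑-neg : ∀ {n} (f : Fin n → ℤ) → ∑[ i < n ] (- f i) ≡ - sum f
∑-neg f = trans (sum-cong-≗ (λ i → sym (-1*i≡-i (f i))))
                (trans (∑-scale (- 1ℤ) f) (-1*i≡-i (sum f)))

∑-split-at : ∀ {n} (x : Fin n) (g : Fin n → ℤ) →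
  sum g ≡ g x + ∑[ y < n ] (off x y * g y)
∑-split-at {suc n} zero g =
  cong (λ s → g zero + s) (trans (sum-cong-≗ (λ y → sym (*-identityˡ (g (suc y)))))
                                 (sym (+-identityˡ _)))
∑-split-at {suc n} (suc x) g =
  trans (cong (λ s → g zero + s) (∑-split-at x (λ y → g (suc y)))) (swap (g zero) (g (suc x)) _)
  where swap : ∀ a b s → a + (b + s) ≡ b + (1ℤ * a + s)
        swap = solve-∀

∑∑ : ∀ {n} → (Fin n → Fin n → ℤ) → ℤ
∑∑ {n} f = ∑[ x < n ] ∑[ y < n ] f x y

∑∑-cong : ∀ {n} {f g : Fin n → Fin n → ℤ} → (∀ x y → f x y ≡ g x y) → ∑∑ f ≡ ∑∑ g
∑∑-cong f≗g = sum-cong-≗ (λ x → sum-cong-≗ (f≗g x))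

∑∑-+ : ∀ {n} (f g : Fin n → Fin n → ℤ) → ∑∑ (λ x y → f x y + g x y) ≡ ∑∑ f + ∑∑ g
∑∑-+ f g = trans (sum-cong-≗ (λ x → ∑-distrib-+ (f x) (g x)))
                 (∑-distrib-+ (λ x → sum (f x)) (λ x → sum (g x)))

∑∑-scale : ∀ {n} (k : ℤ) (f : Fin n → Fin n → ℤ) → ∑∑ (λ x y → k * f x y) ≡ k * ∑∑ f
∑∑-scale k f = trans (sum-cong-≗ (λ x → ∑-scale k (f x))) (∑-scale k (λ x → sum (f x)))

∑∑-zero : ∀ n → ∑∑ {n} (λ _ _ → 0ℤ) ≡ 0ℤ
∑∑-zero n = trans (sum-cong-≗ {n} (λ _ → ∑-zero n)) (∑-zero n)

∑∑-row : ∀ {n} (g : Fin n → ℤ) → ∑∑ (λ x y → g x) ≡ + n * sum g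
∑∑-row {n} g = trans (sum-cong-≗ (λ x → ∑-const n (g x))) (∑-scale (+ n) g)

∑∑-column : ∀ {n} (g : Fin n → ℤ) → ∑∑ (λ x y → g y) ≡ + n * sum g
∑∑-column {n} g = ∑-const n (sum g)

∑∑-transpose : ∀ {n} (f : Fin n → Fin n → ℤ) → ∑∑ (λ x y → f y x) ≡ ∑∑ f
∑∑-transpose f = ∑-comm (λ x y → f y x)

∑∑-offDiagonal : ∀ {n} (f : Fin n → Fin n → ℤ) →
  ∑∑ f ≡ ∑[ x < n ] f x x + ∑∑ (λ x y → off x y * f x y)
∑∑-offDiagonal f = trans (sum-cong-≗ (λ x → ∑-split-at x (f x)))
                         (∑-distrib-+ (λ x → f x x) (λ x → sum (λ y → off x y * f x y)))

sumL : ∀ {A : Set} → (A → ℤ) → List A → ℤ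
sumL h = foldr (λ e s → h e + s) 0ℤ

sumL-++ : ∀ {A : Set} (h : A → ℤ) (xs ys : List A) → sumL h (xs ++ ys) ≡ sumL h xs + sumL h ys
sumL-++ h []       ys = sym (+-identityˡ (sumL h ys))
sumL-++ h (x ∷ xs) ys = trans (cong (λ s → h x + s) (sumL-++ h xs ys)) (sym (+-assoc (h x) _ _))

sumL-tabulate : ∀ {A : Set} {n} (h : A → ℤ) (g : Fin n → A) → sumL h (tabulate g) ≡ ∑[ i < n ] h (g i)
sumL-tabulate {n = zero}  h g = refl
sumL-tabulate {n = suc n} h g = cong (λ s → h (g zero) + s) (sumL-tabulate h (λ i → g (suc i)))

sumL-concat-tabulate : ∀ {A : Set} {n} (h : A → ℤ) (f : Fin n → List A) →
  sumL h (concat (tabulate f)) ≡ ∑[ i < n ] sumL h (f i)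
sumL-concat-tabulate {n = zero}  h f = refl
sumL-concat-tabulate {n = suc n} h f =
  trans (sumL-++ h (f zero) _) (cong (λ s → sumL h (f zero) + s) (sumL-concat-tabulate h (λ i → f (suc i))))

sumL-filter : ∀ {A : Set} {P : A → Set} (P? : ∀ e → Dec (P e)) (h : A → ℤ) (xs : List A) →
  sumL h (filter P? xs) ≡ sumL (λ e → 𝟙 (does (P? e)) * h e) xs
sumL-filter P? h []       = refl
sumL-filter P? h (e ∷ xs) with does (P? e)
... | true  = cong₂ _+_ (sym (*-identityˡ (h e))) (sumL-filter P? h xs)
... | false = trans (sumL-filter P? h xs)
                    (sym (trans (cong (_+ rest) (*-zeroˡ (h e))) (+-identityˡ rest)))
  where rest : ℤ
        rest = sumL (λ e → 𝟙 (does (P? e)) * h e) xs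

sumL-scale : ∀ {A : Set} (k : ℤ) (h : A → ℤ) (xs : List A) → sumL (λ e → k * h e) xs ≡ k * sumL h xs
sumL-scale k h []       = sym (*-zeroʳ k)
sumL-scale k h (e ∷ xs) = trans (cong (λ s → k * h e + s) (sumL-scale k h xs)) (sym (*-distribˡ-+ k (h e) _))

sumL-nonneg : ∀ {A : Set} (h : A → ℤ) → (∀ e → 0ℤ ≤ h e) → ∀ xs → 0ℤ ≤ sumL h xs
sumL-nonneg h h≥0 []       = ≤-refl
sumL-nonneg h h≥0 (e ∷ xs) = +-mono-≤ (h≥0 e) (sumL-nonneg h h≥0 xs)

sumL-massless : ∀ {A : Set} (w g : A → ℤ) → (∀ e → 0ℤ ≤ w e) →
  ∀ xs → sumL w xs ≡ 0ℤ → sumL (λ e → w e * g e) xs ≡ 0ℤ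
sumL-massless w g w≥0 []       _    = refl
sumL-massless w g w≥0 (e ∷ xs) mass≡0 = begin
  w e * g e + sumL (λ e → w e * g e) xs  ≡⟨ cong₂ _+_ (cong (_* g e) we≡0) (sumL-massless w g w≥0 xs rest≡0) ⟩
  0ℤ * g e + 0ℤ                          ≡⟨ cong (_+ 0ℤ) (*-zeroˡ (g e)) ⟩
  0ℤ                                     ∎
  where
  open ≡-Reasoning
  rest≥0 : 0ℤ ≤ sumL w xs
  rest≥0 = sumL-nonneg w w≥0 xs
  we≡0 : w e ≡ 0ℤ
  we≡0 = ≤-antisym (≤-trans (i≤i+j (w e) _ {{nonNegative rest≥0}}) (≤-reflexive mass≡0)) (w≥0 e)
  rest≡0 : sumL w xs ≡ 0ℤ
  rest≡0 = trans (sym (+-identityˡ _)) (trans (cong (_+ sumL w xs) (sym we≡0)) mass≡0)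

allPairs : ∀ n → List (Fin n × Fin n)
allPairs n = concat (tabulate (λ x → tabulate (λ y → (x , y))))

sumL-allPairs : ∀ {n} (h : Fin n × Fin n → ℤ) → sumL h (allPairs n) ≡ ∑∑ (λ x y → h (x , y))
sumL-allPairs {n} h = trans (sumL-concat-tabulate h (λ x → tabulate (λ y → (x , y))))
                             (sum-cong-≗ (λ x → sumL-tabulate h (λ y → (x , y))))

sumℤ-allFin : ∀ {n} (f : Fin n → ℤ) → sumℤ (map f (allFin n)) ≡ sum f
sumℤ-allFin f = trans (cong sumℤ (map-tabulate (λ i → i) f)) (sumL-tabulate (λ z → z) f)

-- z / 1 in normal form.
toℚ′ : ℤ → ℚ
toℚ′ z = mkℚ z 0 (C.sym (1-coprimeTo ∣ z ∣))

toℚ≡toℚ′ : ∀ z → toℚ z ≡ toℚ′ z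
toℚ≡toℚ′ z = ℚP.↥p/↧p≡p (toℚ′ z)

toℚ-+ : ∀ a b → toℚ (a + b) ≡ toℚ a ℚ.+ toℚ b
toℚ-+ a b rewrite toℚ≡toℚ′ a | toℚ≡toℚ′ b =
  cong (ℚ._/ 1) (cong₂ _+_ (sym (*-identityʳ a)) (sym (*-identityʳ b)))

toℚ-* : ∀ a b → toℚ (a * b) ≡ toℚ a ℚ.* toℚ b
toℚ-* a b rewrite toℚ≡toℚ′ a | toℚ≡toℚ′ b = refl

toℚ-injective : ∀ {a b} → toℚ a ≡ toℚ b → a ≡ b
toℚ-injective {a} {b} e = cong ℚ.↥_ (trans (sym (toℚ≡toℚ′ a)) (trans e (toℚ≡toℚ′ b)))

toℚ-mono-≤ : ∀ {a b} → a ≤ b → toℚ a ℚ.≤ toℚ b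
toℚ-mono-≤ {a} {b} a≤b rewrite toℚ≡toℚ′ a | toℚ≡toℚ′ b =
  ℚ.*≤* (subst₂ _≤_ (sym (*-identityʳ a)) (sym (*-identityʳ b)) a≤b)

toℚ-sum₃-scaled : ∀ a b d i → toℚ a ℚ.* i ℚ.+ (toℚ b ℚ.* i ℚ.+ toℚ d ℚ.* i) ≡ toℚ (a + b + d) ℚ.* i
toℚ-sum₃-scaled a b d i =
  trans (distrib (toℚ a) (toℚ b) (toℚ d) i)
        (cong (ℚ._* i) (sym (trans (toℚ-+ (a + b) d) (cong (ℚ._+ toℚ d) (toℚ-+ a b)))))
  where distrib : ∀ a b d i → a ℚ.* i ℚ.+ (b ℚ.* i ℚ.+ d ℚ.* i) ≡ (a ℚ.+ b ℚ.+ d) ℚ.* i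
        distrib = solve 4 (λ a b d i → a :* i :+ (b :* i :+ d :* i) := (a :+ b :+ d) :* i) refl

0≤* : ∀ {p q} → 0ℚ ℚ.≤ p → 0ℚ ℚ.≤ q → 0ℚ ℚ.≤ p ℚ.* q
0≤* {p} {q} 0≤p 0≤q = ℚP.nonNegative⁻¹ (p ℚ.* q)
  {{ℚP.nonNeg*nonNeg⇒nonNeg p {{ℚ.nonNegative 0≤p}} q {{ℚ.nonNegative 0≤q}}}}

recip : ℕ → ℚ
recip k = ℚ.1/ toℚ′ (+ suc k)

recip≥0 : ∀ k → 0ℚ ℚ.≤ recip k
recip≥0 k = ℚP.nonNegative⁻¹ (recip k)
  {{ℚP.pos⇒nonNeg (recip k) {{ℚP.1/pos⇒pos (toℚ′ (+ suc k))}}}}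

*-recip : ∀ k → toℚ (+ suc k) ℚ.* recip k ≡ 1ℚ
*-recip k rewrite toℚ≡toℚ′ (+ suc k) = ℚP.*-inverseʳ (toℚ′ (+ suc k))

module _ {E : Set} (w gx gy : E → ℤ) where

  normalized : ℚ → List E → List (ℚ × Pt)
  normalized i = map (λ e → (toℚ (w e) ℚ.* i , (toℚ (gx e) , toℚ (gy e))))

  normalized-weight : ∀ i xs →
    foldr (λ wq s → proj₁ wq ℚ.+ s) 0ℚ (normalized i xs) ≡ toℚ (sumL w xs) ℚ.* i
  normalized-weight i []       = sym (ℚP.*-zeroˡ i)
  normalized-weight i (e ∷ xs) rewrite normalized-weight i xs | toℚ-+ (w e) (sumL w xs) =
    solve 3 (λ a b i → a :* i :+ b :* i := (a :+ b) :* i) refl (toℚ (w e)) (toℚ (sumL w xs)) i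

  scaledSum : ℚ → List E → Pt
  scaledSum i xs = (toℚ (sumL (λ e → w e * gx e) xs) ℚ.* i , toℚ (sumL (λ e → w e * gy e) xs) ℚ.* i)

  normalized-point : ∀ i xs →
    foldr (λ wq s → (proj₁ wq ·ᵖ proj₂ wq) +ᵖ s) 0ᵖ (normalized i xs) ≡ scaledSum i xs
  normalized-point i []       = cong₂ _,_ (sym (ℚP.*-zeroˡ i)) (sym (ℚP.*-zeroˡ i))
  normalized-point i (e ∷ xs) rewrite normalized-point i xs
    | toℚ-+ (w e * gx e) (sumL (λ e → w e * gx e) xs) | toℚ-+ (w e * gy e) (sumL (λ e → w e * gy e) xs)
    | toℚ-* (w e) (gx e) | toℚ-* (w e) (gy e) =
    cong₂ _,_ (regroup (toℚ (w e)) (toℚ (gx e)) _ i) (regroup (toℚ (w e)) (toℚ (gy e)) _ i)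
    where regroup : ∀ a g s i → a ℚ.* i ℚ.* g ℚ.+ s ℚ.* i ≡ (a ℚ.* g ℚ.+ s) ℚ.* i
          regroup = solve 4 (λ a g s i → a :* i :* g :+ s :* i := (a :* g :+ s) :* i) refl

  weighted-mean∈conv : (P : Pt → Set) → (∀ e → 0ℤ ≤ w e) → ∀ i → 0ℚ ℚ.≤ i →
    ∀ xs → All (λ e → P (toℚ (gx e) , toℚ (gy e))) xs → toℚ (sumL w xs) ℚ.* i ≡ 1ℚ →
    InConv P (scaledSum i xs)
  weighted-mean∈conv P w≥0 i i≥0 xs xs∈P total≡1 =
    normalized i xs , entries xs xs∈P , trans (normalized-weight i xs) total≡1 , normalized-point i xs
    where
    entries : ∀ xs → All (λ e → P (toℚ (gx e) , toℚ (gy e))) xs →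
              All (λ wq → 0ℚ ℚ.≤ proj₁ wq × P (proj₂ wq)) (normalized i xs)
    entries []       []           = []
    entries (e ∷ xs) (e∈P ∷ xs∈P) = (0≤* (toℚ-mono-≤ (w≥0 e)) i≥0 , e∈P) ∷ entries xs xs∈P

  class-contribution : (P : Pt → Set) → (∀ e → 0ℤ ≤ w e) → ∀ i → 0ℚ ℚ.≤ i →
    ∀ xs → All (λ e → P (toℚ (gx e) , toℚ (gy e))) xs →
    Σ Pt λ p → (toℚ (sumL w xs) ℚ.* i ≡ 0ℚ ⊎ InConv P p)
             × (toℚ (sumL w xs) ℚ.* i) ·ᵖ p ≡ scaledSum i xs
  class-contribution P w≥0 i i≥0 xs xs∈P with zero-or-suc (sumL w xs) (sumL-nonneg w w≥0 xs)
  ... | inj₁ mass≡0 =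
    0ᵖ , inj₁ (scaled-zero mass≡0) , cong₂ _,_ (vanish gx) (vanish gy)
    where
    scaled-zero : ∀ {a} → a ≡ 0ℤ → toℚ a ℚ.* i ≡ 0ℚ
    scaled-zero refl = ℚP.*-zeroˡ i
    vanish : ∀ g → (toℚ (sumL w xs) ℚ.* i) ℚ.* 0ℚ ≡ toℚ (sumL (λ e → w e * g e) xs) ℚ.* i
    vanish g = trans (ℚP.*-zeroʳ (toℚ (sumL w xs) ℚ.* i)) (sym (scaled-zero (sumL-massless w g w≥0 xs mass≡0)))
  ... | inj₂ (k , mass≡1+k) =
    scaledSum (recip k) xs ,
    inj₂ (weighted-mean∈conv P w≥0 (recip k) (recip≥0 k) xs xs∈P mass·recip≡1) ,
    cong₂ _,_ (rescale (toℚ (sumL (λ e → w e * gx e) xs))) (rescale (toℚ (sumL (λ e → w e * gy e) xs)))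
    where
    mass·recip≡1 : toℚ (sumL w xs) ℚ.* recip k ≡ 1ℚ
    mass·recip≡1 = trans (cong (λ m → toℚ m ℚ.* recip k) mass≡1+k) (*-recip k)
    swap : ∀ m i a j → m ℚ.* i ℚ.* (a ℚ.* j) ≡ (m ℚ.* j) ℚ.* (a ℚ.* i)
    swap = solve 4 (λ m i a j → m :* i :* (a :* j) := (m :* j) :* (a :* i)) refl
    rescale : ∀ a → toℚ (sumL w xs) ℚ.* i ℚ.* (a ℚ.* recip k) ≡ a ℚ.* i
    rescale a = trans (swap (toℚ (sumL w xs)) i a (recip k))
                      (trans (cong (ℚ._* (a ℚ.* i)) mass·recip≡1) (ℚP.*-identityˡ (a ℚ.* i)))

module _ {n : ℕ} (c : PartialChoice n) where

  W-spec : ∀ x y → (choose c x y ≡ nothing × W c x y ≡ 0ℤ)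
                 ⊎ (choose c x y ≡ just x × W c x y ≡ 1ℤ)
                 ⊎ (choose c x y ≡ just y × x ≢ y × W c x y ≡ ℓ₋)
  W-spec x y with choose c x y in eq
  ... | nothing = inj₁ (refl , refl)
  ... | just z with z ≟ x
  ...   | yes refl = inj₂ (inj₁ (refl , refl))
  ...   | no z≢x with member c x y z eq
  ...     | inj₁ z≡x  = ⊥-elim (z≢x z≡x)
  ...     | inj₂ refl = inj₂ (inj₂ (refl , x≢z , refl))
    where x≢z : x ≢ z
          x≢z refl with trans (sym eq) (irrefl c x)
          ... | ()

  private
    just≢nothing : ∀ {z : Fin n} → just z ≢ nothing
    just≢nothing ()

    just-injective : ∀ {z z′ : Fin n} → just z ≡ just z′ → z ≡ z′
    just-injective refl = refl

  W-none : ∀ x y → choose c x y ≡ nothing → W c x y ≡ 0ℤ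
  W-none x y e with W-spec x y
  ... | inj₁ (_ , w)             = w
  ... | inj₂ (inj₁ (e′ , _))     = ⊥-elim (just≢nothing (trans (sym e′) e))
  ... | inj₂ (inj₂ (e′ , _ , _)) = ⊥-elim (just≢nothing (trans (sym e′) e))

  W-first : ∀ x y → choose c x y ≡ just x → W c x y ≡ 1ℤ
  W-first x y e with W-spec x y
  ... | inj₁ (e′ , _)              = ⊥-elim (just≢nothing (trans (sym e) e′))
  ... | inj₂ (inj₁ (_ , w))        = w
  ... | inj₂ (inj₂ (e′ , x≢y , _)) = ⊥-elim (x≢y (just-injective (trans (sym e) e′)))

  W-second : ∀ x y → x ≢ y → choose c x y ≡ just y → W c x y ≡ ℓ₋
  W-second x y x≢y e with W-spec x y
  ... | inj₁ (e′ , _)            = ⊥-elim (just≢nothing (trans (sym e) e′))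
  ... | inj₂ (inj₁ (e′ , _))     = ⊥-elim (x≢y (sym (just-injective (trans (sym e) e′))))
  ... | inj₂ (inj₂ (_ , _ , w))  = w

  W≡1⇒chooses-first : ∀ x y → W c x y ≡ 1ℤ → choose c x y ≡ just x
  W≡1⇒chooses-first x y w with W-spec x y
  ... | inj₁ (_ , w′)            = ⊥-elim (1≢0 (trans (sym w) w′))
    where 1≢0 : 1ℤ ≢ 0ℤ
          1≢0 ()
  ... | inj₂ (inj₁ (e , _))      = e
  ... | inj₂ (inj₂ (_ , _ , w′)) = ⊥-elim (1≢-1 (trans (sym w) w′))
    where 1≢-1 : 1ℤ ≢ ℓ₋
          1≢-1 ()

  W-diag : ∀ x → W c x x ≡ 0ℤ
  W-diag x = W-none x x (irrefl c x)

  W-values : ∀ x y → Trit (W c x y)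
  W-values x y with W-spec x y
  ... | inj₁ (_ , w)            = inj₂ (inj₁ w)
  ... | inj₂ (inj₁ (_ , w))     = inj₂ (inj₂ w)
  ... | inj₂ (inj₂ (_ , _ , w)) = inj₁ w

  W-antisym : ∀ x y → W c y x ≡ - W c x y
  W-antisym x y with W-spec x y
  ... | inj₁ (e , w) =
    trans (W-none y x (trans (choose-sym c y x) e)) (cong -_ (sym w))
  ... | inj₂ (inj₁ (e , w)) =
    trans (W-second y x y≢x (trans (choose-sym c y x) e)) (cong -_ (sym w))
    where y≢x : y ≢ x
          y≢x refl = just≢nothing (trans (sym e) (irrefl c x))
  ... | inj₂ (inj₂ (e , x≢y , w)) =
    trans (W-first y x (trans (choose-sym c y x) e)) (cong -_ (sym w))

  v : Fin n → ℤ
  v x = sum (W c x)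

  val≡v : ∀ x → val c x ≡ v x
  val≡v x = sumℤ-allFin (W c x)

  ∑-column : ∀ y → ∑[ x < n ] W c x y ≡ - v y
  ∑-column y = trans (sum-cong-≗ (W-antisym y)) (∑-neg (W c y))

  -- Valences sum to zero: every won comparison is lost by someone.
  ∑v≡0 : sum v ≡ 0ℤ
  ∑v≡0 = self-neg⇒0 (sum v) (begin
    sum v                          ≡⟨ ∑∑-transpose (W c) ⟨
    ∑[ x < n ] ∑[ y < n ] W c y x  ≡⟨ sum-cong-≗ ∑-column ⟩
    ∑[ x < n ] (- v x)             ≡⟨ ∑-neg v ⟩
    - sum v                        ∎)
    where open ≡-Reasoning

  N S Q : ℤ
  N = + n
  S = ∑[ x < n ] (v x * v x)
  Q = ∑∑ (λ x y → W c x y * W c x y)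

  data Monomial : Set where
    𝟏 𝐖 𝐱 𝐲 𝐖𝐖 𝐖𝐱 𝐖𝐲 𝐱𝐱 𝐱𝐲 𝐲𝐲 : Monomial

  mono : Monomial → Fin n → Fin n → ℤ
  mono 𝟏  x y = 1ℤ
  mono 𝐖  x y = W c x y
  mono 𝐱  x y = v x
  mono 𝐲  x y = v y
  mono 𝐖𝐖 x y = W c x y * W c x y
  mono 𝐖𝐱 x y = W c x y * v x
  mono 𝐖𝐲 x y = W c x y * v y
  mono 𝐱𝐱 x y = v x * v x
  mono 𝐱𝐲 x y = v x * v y
  mono 𝐲𝐲 x y = v y * v y

  moment : Monomial → ℤ
  moment 𝟏  = N * N
  moment 𝐖  = 0ℤ
  moment 𝐱  = 0ℤ
  moment 𝐲  = 0ℤ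
  moment 𝐖𝐖 = Q
  moment 𝐖𝐱 = S
  moment 𝐖𝐲 = - S
  moment 𝐱𝐱 = N * S
  moment 𝐱𝐲 = 0ℤ
  moment 𝐲𝐲 = N * S

  -- Each monomial sums over all ordered pairs to its moment; everything
  -- reduces to  ∑ v = 0  and the column sums of W.
  ∑∑-mono : ∀ m → ∑∑ (mono m) ≡ moment m
  ∑∑-mono 𝟏  = trans (∑∑-row {n} (λ _ → 1ℤ)) (cong (N *_) (trans (∑-const n 1ℤ) (*-identityʳ N)))
  ∑∑-mono 𝐖  = ∑v≡0
  ∑∑-mono 𝐱  = trans (∑∑-row v) (trans (cong (N *_) ∑v≡0) (*-zeroʳ N))
  ∑∑-mono 𝐲  = trans (∑∑-column v) (trans (cong (N *_) ∑v≡0) (*-zeroʳ N))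
  ∑∑-mono 𝐖𝐖 = refl
  ∑∑-mono 𝐖𝐱 = sum-cong-≗ (λ x → trans (sum-cong-≗ (λ y → *-comm (W c x y) (v x)))
                                       (∑-scale (v x) (W c x)))
  ∑∑-mono 𝐖𝐲 = begin
    ∑∑ (λ x y → W c x y * v y)             ≡⟨ ∑∑-transpose (λ x y → W c x y * v y) ⟨
    ∑[ y < n ] ∑[ x < n ] (W c x y * v y)  ≡⟨ sum-cong-≗ (λ y → *-distribʳ-sum (v y) (λ x → W c x y)) ⟨
    ∑[ y < n ] (∑[ x < n ] W c x y * v y)  ≡⟨ sum-cong-≗ (λ y → cong (_* v y) (∑-column y)) ⟩
    ∑[ y < n ] (- v y * v y)               ≡⟨ sum-cong-≗ (λ y → sym (neg-distribˡ-* (v y) (v y))) ⟩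
    ∑[ y < n ] (- (v y * v y))             ≡⟨ ∑-neg (λ y → v y * v y) ⟩
    - S                                    ∎
    where open ≡-Reasoning
  ∑∑-mono 𝐱𝐱 = ∑∑-row (λ x → v x * v x)
  ∑∑-mono 𝐱𝐲 = trans (sum-cong-≗ (λ x → trans (∑-scale (v x) v) (trans (cong (v x *_) ∑v≡0) (*-zeroʳ (v x)))))
                     (∑-zero n)
  ∑∑-mono 𝐲𝐲 = ∑∑-column (λ y → v y * v y)

  combine : List (ℤ × Monomial) → Fin n → Fin n → ℤ
  combine []             x y = 0ℤ
  combine ((k , m) ∷ ts) x y = k * mono m x y + combine ts x y

  momentOf : List (ℤ × Monomial) → ℤ
  momentOf []             = 0ℤ
  momentOf ((k , m) ∷ ts) = k * moment m + momentOf ts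

  ∑∑-combine : ∀ ts → ∑∑ (combine ts) ≡ momentOf ts
  ∑∑-combine []             = ∑∑-zero n
  ∑∑-combine ((k , m) ∷ ts) = begin
    ∑∑ (λ x y → k * mono m x y + combine ts x y)  ≡⟨ ∑∑-+ (λ x y → k * mono m x y) (combine ts) ⟩
    ∑∑ (λ x y → k * mono m x y) + ∑∑ (combine ts) ≡⟨ cong₂ _+_ (∑∑-scale k (mono m)) (∑∑-combine ts) ⟩
    k * ∑∑ (mono m) + momentOf ts                 ≡⟨ cong (λ s → k * s + momentOf ts) (∑∑-mono m) ⟩
    k * moment m + momentOf ts                    ∎
    where open ≡-Reasoning

  record LinearForm : Set where
    constructor lin
    field κ ω ξ η : ℤ

  ⟦_⟧ : LinearForm → Fin n → Fin n → ℤ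
  ⟦ lin κ ω ξ η ⟧ x y = κ + ω * W c x y + ξ * v x + η * v y

  gram : LinearForm → LinearForm → ℤ
  gram (lin κ ω ξ η) (lin κ′ ω′ ξ′ η′) =
    κ * κ′ * (N * N) + ω * ω′ * Q + (ω * ξ′ + ξ * ω′) * S - (ω * η′ + η * ω′) * S
    + (ξ * ξ′ + η * η′) * (N * S)

  ∑∑-gram : ∀ f g → ∑∑ (λ x y → ⟦ f ⟧ x y * ⟦ g ⟧ x y) ≡ gram f g
  ∑∑-gram (lin κ ω ξ η) (lin κ′ ω′ ξ′ η′) = begin
    ∑∑ (λ x y → ⟦ lin κ ω ξ η ⟧ x y * ⟦ lin κ′ ω′ ξ′ η′ ⟧ x y)
      ≡⟨ ∑∑-cong (λ x y → expand κ ω ξ η κ′ ω′ ξ′ η′ (W c x y) (v x) (v y)) ⟩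
    ∑∑ (combine terms)
      ≡⟨ ∑∑-combine terms ⟩
    momentOf terms
      ≡⟨ collect κ ω ξ η κ′ ω′ ξ′ η′ N S Q ⟩
    gram (lin κ ω ξ η) (lin κ′ ω′ ξ′ η′) ∎
    where
    open ≡-Reasoning
    terms : List (ℤ × Monomial)
    terms = (κ * κ′ , 𝟏) ∷ (κ * ω′ + ω * κ′ , 𝐖) ∷ (κ * ξ′ + ξ * κ′ , 𝐱) ∷ (κ * η′ + η * κ′ , 𝐲)
          ∷ (ω * ω′ , 𝐖𝐖) ∷ (ω * ξ′ + ξ * ω′ , 𝐖𝐱) ∷ (ω * η′ + η * ω′ , 𝐖𝐲)
          ∷ (ξ * ξ′ , 𝐱𝐱) ∷ (ξ * η′ + η * ξ′ , 𝐱𝐲) ∷ (η * η′ , 𝐲𝐲) ∷ []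
    expand : ∀ κ ω ξ η κ′ ω′ ξ′ η′ w a b →
      (κ + ω * w + ξ * a + η * b) * (κ′ + ω′ * w + ξ′ * a + η′ * b) ≡
      κ * κ′ * 1ℤ + ((κ * ω′ + ω * κ′) * w + ((κ * ξ′ + ξ * κ′) * a + ((κ * η′ + η * κ′) * b
      + (ω * ω′ * (w * w) + ((ω * ξ′ + ξ * ω′) * (w * a) + ((ω * η′ + η * ω′) * (w * b)
      + (ξ * ξ′ * (a * a) + ((ξ * η′ + η * ξ′) * (a * b) + (η * η′ * (b * b) + 0ℤ)))))))))
    expand = solve-∀
    collect : ∀ κ ω ξ η κ′ ω′ ξ′ η′ N S Q →
      κ * κ′ * (N * N) + ((κ * ω′ + ω * κ′) * 0ℤ + ((κ * ξ′ + ξ * κ′) * 0ℤ + ((κ * η′ + η * κ′) * 0ℤ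
      + (ω * ω′ * Q + ((ω * ξ′ + ξ * ω′) * S + ((ω * η′ + η * ω′) * - S
      + (ξ * ξ′ * (N * S) + ((ξ * η′ + η * ξ′) * 0ℤ + (η * η′ * (N * S) + 0ℤ))))))))) ≡
      κ * κ′ * (N * N) + ω * ω′ * Q + (ω * ξ′ + ξ * ω′) * S - (ω * η′ + η * ω′) * S
      + (ξ * ξ′ + η * η′) * (N * S)
    collect = solve-∀

  imbalanced⇒W≡1 : Imbalanced c → ∃ λ p → ∃ λ q → W c p q ≡ 1ℤ
  imbalanced⇒W≡1 imb with ¬∀⟶∃¬ n (λ x → v x ≡ 0ℤ) (λ x → v x ℤ.≟ 0ℤ)
                                (λ v≡0 → imb (λ x → trans (val≡v x) (v≡0 x)))
  ... | x , vx≢0 with ¬∀⟶∃¬ n (λ y → W c x y ≡ 0ℤ) (λ y → W c x y ℤ.≟ 0ℤ)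
                            (λ W≡0 → vx≢0 (trans (sum-cong-≗ W≡0) (∑-zero n)))
  ...   | y , Wxy≢0 with W-values x y
  ...     | inj₁ Wxy≡-1       = y , x , trans (W-antisym x y) (cong -_ Wxy≡-1)
  ...     | inj₂ (inj₁ Wxy≡0) = ⊥-elim (Wxy≢0 Wxy≡0)
  ...     | inj₂ (inj₂ Wxy≡1) = x , y , Wxy≡1

  -- If W is additive along paths and W(p,q) = 1, then c is partisan: the
  -- winning class is the set of elements that beat q.
  additive⇒partisan : (∀ x y z → W c x y + W c y z ≡ W c x z) →
                      ∀ p q → W c p q ≡ 1ℤ → Partisan c
  additive⇒partisan additive p q Wpq≡1 =
    beats-q , (p , dec-true (W c p q ℤ.≟ 1ℤ) Wpq≡1)
            , (q , dec-false (W c q q ℤ.≟ 1ℤ) (λ Wqq≡1 → 0≢1 (trans (sym (W-diag q)) Wqq≡1)))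
            , λ x y → mk⇔ (chooses⇒classes x y) (classes⇒chooses x y)
    where
    0≢1 : 0ℤ ≢ 1ℤ
    0≢1 ()

    beats-q : Fin n → Bool
    beats-q x = does (W c x q ℤ.≟ 1ℤ)

    -- W(x,q) = W(x,p) + 1 with W(x,p) ≥ -1, so W(x,q) ∈ {0,1}.
    W-q : ∀ x → Bit (W c x q)
    W-q x = trit-successor (W-values x p) (W-values x q)
              (trans (cong (λ s → W c x p + s) (sym Wpq≡1)) (additive x p q))

    W-q≡0 : ∀ x → beats-q x ≡ false → W c x q ≡ 0ℤ
    W-q≡0 x not-beats with W-q x
    ... | inj₁ Wxq≡0 = Wxq≡0
    ... | inj₂ Wxq≡1 with trans (sym (dec-true (W c x q ℤ.≟ 1ℤ) Wxq≡1)) not-beats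
    ...   | ()

    W-via-q : ∀ x y → W c x y ≡ W c x q + - W c y q
    W-via-q x y = trans (sym (additive x q y)) (cong (λ s → W c x q + s) (W-antisym y q))

    chooses⇒classes : ∀ x y → choose c x y ≡ just x → beats-q x ≡ true × beats-q y ≡ false
    chooses⇒classes x y chooses-x with bit-difference (W-q x) (W-q y)
                                          (trans (sym (W-via-q x y)) (W-first x y chooses-x))
    ... | Wxq≡1 , Wyq≡0 =
      dec-true (W c x q ℤ.≟ 1ℤ) Wxq≡1 ,
      dec-false (W c y q ℤ.≟ 1ℤ) (λ Wyq≡1 → 0≢1 (trans (sym Wyq≡0) Wyq≡1))

    classes⇒chooses : ∀ x y → beats-q x ≡ true × beats-q y ≡ false → choose c x y ≡ just x
    classes⇒chooses x y (x-beats , y-not) = W≡1⇒chooses-first x y (begin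
      W c x y              ≡⟨ W-via-q x y ⟩
      W c x q + - W c y q  ≡⟨ cong₂ (λ a b → a + - b) (toWitness′ x-beats) (W-q≡0 y y-not) ⟩
      1ℤ                   ∎)
      where
      open ≡-Reasoning
      toWitness′ : beats-q x ≡ true → W c x q ≡ 1ℤ
      toWitness′ e with W c x q ℤ.≟ 1ℤ
      toWitness′ e  | yes Wxq≡1 = Wxq≡1
      toWitness′ () | no _

  S≡0⇒balanced : S ≡ 0ℤ → Balanced c
  S≡0⇒balanced S≡0 x =
    trans (val≡v x) (square≡0⇒0 (∑-zero⇒terms-zero _ (λ y → square≥0 (v y)) S≡0 x))

  -- The defect  D(x,y) = N W(x,y) − v(x) + v(y)  of W from being additive.
  defect : LinearForm
  defect = lin 0ℤ N (- 1ℤ) 1ℤ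

  ∑∑-defect² : ∑∑ (λ x y → ⟦ defect ⟧ x y * ⟦ defect ⟧ x y) ≡ N * (N * Q - + 2 * S)
  ∑∑-defect² = trans (∑∑-gram defect defect) (evaluate N S Q)
    where
    evaluate : ∀ N S Q →
      0ℤ * 0ℤ * (N * N) + N * N * Q + (N * - 1ℤ + - 1ℤ * N) * S - (N * 1ℤ + 1ℤ * N) * S
      + (- 1ℤ * - 1ℤ + 1ℤ * 1ℤ) * (N * S) ≡ N * (N * Q - + 2 * S)
    evaluate = solve-∀

  -- When N Q = 2 S the defect vanishes, hence W is additive along paths
  -- (the cancellation of N needs X to be nonempty).
  N·Q≡2·S⇒additive : N * Q - + 2 * S ≡ 0ℤ → Fin n →
                     ∀ x y z → W c x y + W c y z ≡ W c x z
  N·Q≡2·S⇒additive NQ≡2S p x y z = *-cancelˡ-≡ N _ _ {{N≢0 p}} (begin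
    N * (W c x y + W c y z)              ≡⟨ *-distribˡ-+ N (W c x y) (W c y z) ⟩
    N * W c x y + N * W c y z            ≡⟨ cong₂ _+_ (N·W x y) (N·W y z) ⟩
    (v x - v y) + (v y - v z)            ≡⟨ telescope (v x) (v y) (v z) ⟩
    v x - v z                            ≡⟨ N·W x z ⟨
    N * W c x z                          ∎)
    where
    open ≡-Reasoning
    N≢0 : Fin n → ℤ.NonZero N
    N≢0 zero    = _
    N≢0 (suc _) = _

    defect² : Fin n → Fin n → ℤ
    defect² x y = ⟦ defect ⟧ x y * ⟦ defect ⟧ x y

    ∑∑defect²≡0 : ∑∑ defect² ≡ 0ℤ
    ∑∑defect²≡0 = trans ∑∑-defect² (trans (cong (N *_) NQ≡2S) (*-zeroʳ N))

    defect≡0 : ∀ x y → ⟦ defect ⟧ x y ≡ 0ℤ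
    defect≡0 x y = square≡0⇒0 (∑-zero⇒terms-zero (defect² x) (defect²≥0 x)
      (∑-zero⇒terms-zero (λ x → sum (defect² x)) (λ x → ∑-nonneg (defect² x) (defect²≥0 x))
                         ∑∑defect²≡0 x) y)
      where defect²≥0 : ∀ x y → 0ℤ ≤ defect² x y
            defect²≥0 x y = square≥0 (⟦ defect ⟧ x y)

    N·W : ∀ x y → N * W c x y ≡ v x - v y
    N·W x y = begin
      N * W c x y                    ≡⟨ split N (W c x y) (v x) (v y) ⟩
      ⟦ defect ⟧ x y + (v x - v y)   ≡⟨ cong (_+ (v x - v y)) (defect≡0 x y) ⟩
      0ℤ + (v x - v y)               ≡⟨ +-identityˡ (v x - v y) ⟩
      v x - v y                      ∎
      where split : ∀ N w a b → N * w ≡ (0ℤ + N * w + - 1ℤ * a + 1ℤ * b) + (a - b)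
            split = solve-∀

    telescope : ∀ a b d → (a - b) + (b - d) ≡ a - d
    telescope = solve-∀

  module WeightedPoints {E : Set} (L : ℤ → List E) (w : E → ℤ) (w≥0 : ∀ e → 0ℤ ≤ w e)
    (px py : ℤ → E → ℤ) (inV : ∀ ℓ → All (λ e → InV c ℓ (toℚ (px ℓ e) , toℚ (py ℓ e))) (L ℓ)) where

    M X Y : ℤ → ℤ
    M ℓ = sumL w (L ℓ)
    X ℓ = sumL (λ e → w e * px ℓ e) (L ℓ)
    Y ℓ = sumL (λ e → w e * py ℓ e) (L ℓ)

    M≥0 : ∀ ℓ → 0ℤ ≤ M ℓ
    M≥0 ℓ = sumL-nonneg w w≥0 (L ℓ)

    T : ℤ
    T = M ℓ₋ + M ℓ₀ + M ℓ₊

    M≤T : M ℓ₋ ≤ T × M ℓ₀ ≤ T × M ℓ₊ ≤ T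
    M≤T = parts≤sum₃ (M≥0 ℓ₋) (M≥0 ℓ₀) (M≥0 ℓ₊)

    module Normalized (k : ℕ) (T≡1+k : T ≡ + suc k) where
      i : ℚ
      i = recip k

      T·i≡1 : toℚ T ℚ.* i ≡ 1ℚ
      T·i≡1 = trans (cong (λ t → toℚ t ℚ.* i) T≡1+k) (*-recip k)

      r : ℤ → ℚ
      r ℓ = toℚ (M ℓ) ℚ.* i

      r∈[0,1] : ∀ ℓ → M ℓ ≤ T → InUnit (r ℓ)
      r∈[0,1] ℓ M≤T = 0≤* (toℚ-mono-≤ (M≥0 ℓ)) (recip≥0 k) ,
        ℚP.≤-trans (ℚP.*-monoʳ-≤-nonNeg i {{ℚ.nonNegative (recip≥0 k)}} (toℚ-mono-≤ M≤T))
                   (ℚP.≤-reflexive T·i≡1)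

      r-total : r ℓ₋ ℚ.+ r ℓ₀ ℚ.+ r ℓ₊ ≡ 1ℚ
      r-total = trans (ℚP.+-assoc (r ℓ₋) (r ℓ₀) (r ℓ₊))
                      (trans (toℚ-sum₃-scaled (M ℓ₋) (M ℓ₀) (M ℓ₊) i) T·i≡1)

      -- i is invertible, so equal coefficients come from equal totals.
      r-injective : ∀ {ℓ ℓ′} → r ℓ ≡ r ℓ′ → M ℓ ≡ M ℓ′
      r-injective {ℓ} {ℓ′} rℓ≡rℓ′ = toℚ-injective (trans (unscale (toℚ (M ℓ)))
        (trans (cong (ℚ._* toℚ T) rℓ≡rℓ′) (sym (unscale (toℚ (M ℓ′))))))
        where
        regroup : ∀ m i t → m ℚ.* i ℚ.* t ≡ m ℚ.* (t ℚ.* i)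
        regroup = solve 3 (λ m i t → m :* i :* t := m :* (t :* i)) refl
        unscale : ∀ m → m ≡ m ℚ.* i ℚ.* toℚ T
        unscale m = sym (trans (regroup m i (toℚ T)) (trans (cong (m ℚ.*_) T·i≡1) (ℚP.*-identityʳ m)))

      contribution : ∀ ℓ → Σ Pt λ p → (r ℓ ≡ 0ℚ ⊎ InConv (InV c ℓ) p)
                                     × r ℓ ·ᵖ p ≡ scaledSum w (px ℓ) (py ℓ) i (L ℓ)
      contribution ℓ = class-contribution w (px ℓ) (py ℓ) (InV c ℓ) w≥0 i (recip≥0 k) (L ℓ) (inV ℓ)

      scaled-total≡0 : ∀ a b d → a + b + d ≡ 0ℤ →
                       toℚ a ℚ.* i ℚ.+ (toℚ b ℚ.* i ℚ.+ toℚ d ℚ.* i) ≡ 0ℚ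
      scaled-total≡0 a b d sum≡0 =
        trans (toℚ-sum₃-scaled a b d i) (trans (cong (λ t → toℚ t ℚ.* i) sum≡0) (ℚP.*-zeroˡ i))

      witness : X ℓ₋ + X ℓ₀ + X ℓ₊ ≡ 0ℤ → Y ℓ₋ + Y ℓ₀ + Y ℓ₊ ≡ 0ℤ → M ℓ₋ ≢ M ℓ₊ →
                ValenceImbalanced c
      witness X-balanced Y-balanced M₋≢M₊ =
        r ℓ₋ , r ℓ₀ , r ℓ₊ , p ℓ₋ , p ℓ₀ , p ℓ₊ ,
        r∈[0,1] ℓ₋ (proj₁ M≤T) , r∈[0,1] ℓ₀ (proj₁ (proj₂ M≤T)) , r∈[0,1] ℓ₊ (proj₂ (proj₂ M≤T)) ,
        r-total , (λ r₋≡r₊ → M₋≢M₊ (r-injective r₋≡r₊)) ,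
        p∈conv ℓ₋ , p∈conv ℓ₀ , p∈conv ℓ₊ ,
        trans (cong₂ _+ᵖ_ (r·p ℓ₋) (cong₂ _+ᵖ_ (r·p ℓ₀) (r·p ℓ₊)))
              (cong₂ _,_ (scaled-total≡0 (X ℓ₋) (X ℓ₀) (X ℓ₊) X-balanced)
                         (scaled-total≡0 (Y ℓ₋) (Y ℓ₀) (Y ℓ₊) Y-balanced))
        where
        p : ℤ → Pt
        p ℓ = proj₁ (contribution ℓ)
        p∈conv : ∀ ℓ → r ℓ ≡ 0ℚ ⊎ InConv (InV c ℓ) (p ℓ)
        p∈conv ℓ = proj₁ (proj₂ (contribution ℓ))
        r·p : ∀ ℓ → r ℓ ·ᵖ p ℓ ≡ scaledSum w (px ℓ) (py ℓ) i (L ℓ)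
        r·p ℓ = proj₂ (proj₂ (contribution ℓ))

    valence-imbalanced : X ℓ₋ + X ℓ₀ + X ℓ₊ ≡ 0ℤ → Y ℓ₋ + Y ℓ₀ + Y ℓ₊ ≡ 0ℤ → M ℓ₋ ≢ M ℓ₊ →
                         ValenceImbalanced c
    valence-imbalanced X-balanced Y-balanced M₋≢M₊
      with zero-or-suc T (+-mono-≤ (+-mono-≤ (M≥0 ℓ₋) (M≥0 ℓ₀)) (M≥0 ℓ₊))
    -- T = 0 would force M₋₁ = 0 = M₁
    ... | inj₁ T≡0 = ⊥-elim (M₋≢M₊ (trans (massless ℓ₋ (proj₁ M≤T)) (sym (massless ℓ₊ (proj₂ (proj₂ M≤T))))))
      where massless : ∀ ℓ → M ℓ ≤ T → M ℓ ≡ 0ℤ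
            massless ℓ M≤T = ≤-antisym (≤-trans M≤T (≤-reflexive T≡0)) (M≥0 ℓ)
    ... | inj₂ (k , T≡1+k) = Normalized.witness k T≡1+k X-balanced Y-balanced M₋≢M₊

  InClass : ℤ → Fin n × Fin n → Set
  InClass ℓ (x , y) = x ≢ y × W c x y ≡ ℓ

  inClass? : ∀ ℓ e → Dec (InClass ℓ e)
  inClass? ℓ (x , y) = ¬? (x ≟ y) ×-dec (W c x y ℤ.≟ ℓ)

  classPairs : ℤ → List (Fin n × Fin n)
  classPairs ℓ = filter (inClass? ℓ) (allPairs n)

  classPoint : ℤ → Fin n × Fin n → ℤ × ℤ
  classPoint ℓ (x , y) = val c x - ℓ , val c y + ℓ

  classPoints∈V : ∀ ℓ → All (λ e → InV c ℓ (toℚ (proj₁ (classPoint ℓ e)) , toℚ (proj₂ (classPoint ℓ e))))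
                            (classPairs ℓ)
  classPoints∈V ℓ = All.map (λ { {x , y} (x≢y , Wxy≡ℓ) → x , y , x≢y , Wxy≡ℓ , refl })
                            (all-filter (inClass? ℓ) (allPairs n))

  ∑-over-classes : (h : ℤ → Fin n → Fin n → ℤ) →
    sumL (λ e → h ℓ₋ (proj₁ e) (proj₂ e)) (classPairs ℓ₋)
    + sumL (λ e → h ℓ₀ (proj₁ e) (proj₂ e)) (classPairs ℓ₀)
    + sumL (λ e → h ℓ₊ (proj₁ e) (proj₂ e)) (classPairs ℓ₊)
    ≡ ∑∑ (λ x y → off x y * h (W c x y) x y)
  ∑-over-classes h = begin
    S₋ + S₀ + S₊
      ≡⟨ cong₂ _+_ (cong₂ _+_ (as-∑∑ ℓ₋) (as-∑∑ ℓ₀)) (as-∑∑ ℓ₊) ⟩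
    ∑∑ (part ℓ₋) + ∑∑ (part ℓ₀) + ∑∑ (part ℓ₊)
      ≡⟨ cong (_+ ∑∑ (part ℓ₊)) (∑∑-+ (part ℓ₋) (part ℓ₀)) ⟨
    ∑∑ (λ x y → part ℓ₋ x y + part ℓ₀ x y) + ∑∑ (part ℓ₊)
      ≡⟨ ∑∑-+ (λ x y → part ℓ₋ x y + part ℓ₀ x y) (part ℓ₊) ⟨
    ∑∑ (λ x y → part ℓ₋ x y + part ℓ₀ x y + part ℓ₊ x y)
      ≡⟨ ∑∑-cong (λ x y → split-by-value (not (does (x ≟ y))) (W-values x y) (λ ℓ → h ℓ x y)) ⟩
    ∑∑ (λ x y → off x y * h (W c x y) x y) ∎
    where
    open ≡-Reasoning
    S₋ S₀ S₊ : ℤ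
    S₋ = sumL (λ e → h ℓ₋ (proj₁ e) (proj₂ e)) (classPairs ℓ₋)
    S₀ = sumL (λ e → h ℓ₀ (proj₁ e) (proj₂ e)) (classPairs ℓ₀)
    S₊ = sumL (λ e → h ℓ₊ (proj₁ e) (proj₂ e)) (classPairs ℓ₊)
    part : ℤ → Fin n → Fin n → ℤ
    part ℓ x y = 𝟙 (does (inClass? ℓ (x , y))) * h ℓ x y
    as-∑∑ : ∀ ℓ → sumL (λ e → h ℓ (proj₁ e) (proj₂ e)) (classPairs ℓ) ≡ ∑∑ (part ℓ)
    as-∑∑ ℓ = trans (sumL-filter (inClass? ℓ) _ (allPairs n))
                    (sumL-allPairs (λ e → 𝟙 (does (inClass? ℓ e)) * h ℓ (proj₁ e) (proj₂ e)))

  -- The diagonal carries no comparison, so the off-diagonal indicator can be dropped next to W.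
  off·W : ∀ x y b → off x y * (W c x y * b) ≡ W c x y * b
  off·W x y b with x ≟ y
  ... | yes refl = trans (*-zeroˡ (W c x x * b)) (sym (trans (cong (_* b) (W-diag x)) (*-zeroˡ b)))
  ... | no _     = *-identityˡ (W c x y * b)

  pair-weights⇒valence-imbalanced : (a : Fin n → Fin n → ℤ) → (∀ x y → 0ℤ ≤ a x y) →
    ∑∑ (λ x y → off x y * (a x y * (v x - W c x y))) ≡ 0ℤ →
    ∑∑ (λ x y → off x y * (a x y * (v y + W c x y))) ≡ 0ℤ →
    ∑∑ (λ x y → W c x y * a x y) ≢ 0ℤ →
    ValenceImbalanced c
  pair-weights⇒valence-imbalanced a a≥0 first≡0 second≡0 ∑∑Wa≢0 =
    WeightedPoints.valence-imbalanced classPairs weight (λ e → a≥0 (proj₁ e) (proj₂ e))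
      (λ ℓ e → proj₁ (classPoint ℓ e)) (λ ℓ e → proj₂ (classPoint ℓ e)) classPoints∈V
      (trans (∑-over-classes (λ ℓ x y → a x y * (val c x - ℓ)))
             (trans (∑∑-cong (λ x y → cong (λ t → off x y * (a x y * (t - W c x y))) (val≡v x))) first≡0))
      (trans (∑-over-classes (λ ℓ x y → a x y * (val c y + ℓ)))
             (trans (∑∑-cong (λ x y → cong (λ t → off x y * (a x y * (t + W c x y))) (val≡v y))) second≡0))
      M₋≢M₊
    where
    weight : Fin n × Fin n → ℤ
    weight e = a (proj₁ e) (proj₂ e)

    M : ℤ → ℤ
    M ℓ = sumL weight (classPairs ℓ)

    M₊-M₋ : - 1ℤ * M ℓ₋ + 0ℤ * M ℓ₀ + 1ℤ * M ℓ₊ ≡ ∑∑ (λ x y → W c x y * a x y)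
    M₊-M₋ = trans (sym (cong₂ _+_ (cong₂ _+_ (sumL-scale (- 1ℤ) weight (classPairs ℓ₋))
                                                (sumL-scale 0ℤ weight (classPairs ℓ₀)))
                                    (sumL-scale 1ℤ weight (classPairs ℓ₊))))
                  (trans (∑-over-classes (λ ℓ x y → ℓ * a x y)) (∑∑-cong (λ x y → off·W x y (a x y))))

    M₋≢M₊ : M ℓ₋ ≢ M ℓ₊
    M₋≢M₊ M₋≡M₊ = ∑∑Wa≢0 (trans (sym M₊-M₋) (trans (cong (λ m → - 1ℤ * m + 0ℤ * M ℓ₀ + 1ℤ * M ℓ₊) M₋≡M₊)
                                                    (cancels (M ℓ₊) (M ℓ₀))))
      where cancels : ∀ m m₀ → - 1ℤ * m + 0ℤ * m₀ + 1ℤ * m ≡ 0ℤ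
            cancels = solve-∀

  -- The weights.  With α = (N − 2) S and β = Q − S put
  --   a(x,y) = K + α W(x,y) + β (v x − v y),  K = ∑∑ |α W + β (v x − v y)|,
  -- so that a ≥ 0; the Gram form then evaluates all relevant sums.
  α β : ℤ
  α = (N - + 2) * S
  β = Q - S

  shift : LinearForm
  shift = lin 0ℤ α β (- β)

  |shift| : Fin n → Fin n → ℤ
  |shift| x y = + ∣ ⟦ shift ⟧ x y ∣

  K : ℤ
  K = ∑∑ |shift|

  weight : LinearForm
  weight = lin K α β (- β)

  weight≥0 : ∀ x y → 0ℤ ≤ ⟦ weight ⟧ x y
  weight≥0 x y =
    ≤-trans (∣i∣+i≥0 t) (≤-trans (+-monoˡ-≤ t |t|≤K) (≤-reflexive (regroup K α β (W c x y) (v x) (v y))))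
    where
    t : ℤ
    t = ⟦ shift ⟧ x y
    |t|≤K : + ∣ t ∣ ≤ K
    |t|≤K = ≤-trans (∑-term≤ (|shift| x) (λ _ → +≤+ z≤n) y)
                    (∑-term≤ (λ x → sum (|shift| x)) (λ x → ∑-nonneg (|shift| x) (λ _ → +≤+ z≤n)) x)
    regroup : ∀ K α β w a b → K + (0ℤ + α * w + β * a + - β * b) ≡ K + α * w + β * a + - β * b
    regroup = solve-∀

  weight-diag : ∀ x → ⟦ weight ⟧ x x ≡ K
  weight-diag x = collapse K α β (W c x x) (v x) (W-diag x)
    where
    collapse : ∀ K α β w a → w ≡ 0ℤ → K + α * w + β * a + - β * a ≡ K
    collapse K α β w a refl = cancel K α β a
      where cancel : ∀ K α β a → K + α * 0ℤ + β * a + - β * a ≡ K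
            cancel = solve-∀

  -- A weighted double sum of g that vanishes, with g(x,x) = v x, still vanishes
  -- off the diagonal: the diagonal contributes ∑ K · v x = 0.
  drop-diagonal : (g : Fin n → Fin n → ℤ) → (∀ x → g x x ≡ v x) →
    ∑∑ (λ x y → ⟦ weight ⟧ x y * g x y) ≡ 0ℤ →
    ∑∑ (λ x y → off x y * (⟦ weight ⟧ x y * g x y)) ≡ 0ℤ
  drop-diagonal g g-diag full≡0 = begin
    ∑∑ (λ x y → off x y * f x y)                        ≡⟨ +-identityˡ _ ⟨
    0ℤ + ∑∑ (λ x y → off x y * f x y)                   ≡⟨ cong (_+ ∑∑ (λ x y → off x y * f x y)) diagonal≡0 ⟨
    ∑[ x < n ] f x x + ∑∑ (λ x y → off x y * f x y)     ≡⟨ ∑∑-offDiagonal f ⟨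
    ∑∑ f                                                ≡⟨ full≡0 ⟩
    0ℤ                                                  ∎
    where
    open ≡-Reasoning
    f : Fin n → Fin n → ℤ
    f x y = ⟦ weight ⟧ x y * g x y
    diagonal≡0 : ∑[ x < n ] f x x ≡ 0ℤ
    diagonal≡0 = begin
      ∑[ x < n ] f x x                          ≡⟨ sum-cong-≗ (λ x → cong₂ _*_ (weight-diag x) (g-diag x)) ⟩
      ∑[ x < n ] (K * v x)    ≡⟨ ∑-scale K v ⟩
      K * sum v               ≡⟨ cong (K *_) ∑v≡0 ⟩
      K * 0ℤ                  ≡⟨ *-zeroʳ K ⟩
      0ℤ                                        ∎

  -- The choice of α and β makes  α (S − Q) + β (N − 2) S  vanish.
  balance : ∀ N S Q → (N - + 2) * S * (S - Q) + (Q - S) * ((N - + 2) * S) ≡ 0ℤ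
  balance = solve-∀

  first-coordinates : ∑∑ (λ x y → ⟦ weight ⟧ x y * (v x - W c x y)) ≡ 0ℤ
  first-coordinates = begin
    ∑∑ (λ x y → ⟦ weight ⟧ x y * (v x - W c x y))
      ≡⟨ ∑∑-cong (λ x y → cong (⟦ weight ⟧ x y *_) (as-form (W c x y) (v x) (v y))) ⟩
    ∑∑ (λ x y → ⟦ weight ⟧ x y * ⟦ lin 0ℤ (- 1ℤ) 1ℤ 0ℤ ⟧ x y)
      ≡⟨ ∑∑-gram weight (lin 0ℤ (- 1ℤ) 1ℤ 0ℤ) ⟩
    gram weight (lin 0ℤ (- 1ℤ) 1ℤ 0ℤ)
      ≡⟨ evaluate K α β N S Q ⟩
    α * (S - Q) + β * ((N - + 2) * S)
      ≡⟨ balance N S Q ⟩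
    0ℤ ∎
    where
    open ≡-Reasoning
    as-form : ∀ w a b → a - w ≡ 0ℤ + - 1ℤ * w + 1ℤ * a + 0ℤ * b
    as-form = solve-∀
    evaluate : ∀ K α β N S Q →
      K * 0ℤ * (N * N) + α * - 1ℤ * Q + (α * 1ℤ + β * - 1ℤ) * S - (α * 0ℤ + - β * - 1ℤ) * S
      + (β * 1ℤ + - β * 0ℤ) * (N * S) ≡ α * (S - Q) + β * ((N - + 2) * S)
    evaluate = solve-∀

  second-coordinates : ∑∑ (λ x y → ⟦ weight ⟧ x y * (v y + W c x y)) ≡ 0ℤ
  second-coordinates = begin
    ∑∑ (λ x y → ⟦ weight ⟧ x y * (v y + W c x y))
      ≡⟨ ∑∑-cong (λ x y → cong (⟦ weight ⟧ x y *_) (as-form (W c x y) (v x) (v y))) ⟩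
    ∑∑ (λ x y → ⟦ weight ⟧ x y * ⟦ lin 0ℤ 1ℤ 0ℤ 1ℤ ⟧ x y)
      ≡⟨ ∑∑-gram weight (lin 0ℤ 1ℤ 0ℤ 1ℤ) ⟩
    gram weight (lin 0ℤ 1ℤ 0ℤ 1ℤ)
      ≡⟨ evaluate K α β N S Q ⟩
    - (α * (S - Q) + β * ((N - + 2) * S))
      ≡⟨ cong -_ (balance N S Q) ⟩
    0ℤ ∎
    where
    open ≡-Reasoning
    as-form : ∀ w a b → b + w ≡ 0ℤ + 1ℤ * w + 0ℤ * a + 1ℤ * b
    as-form = solve-∀
    evaluate : ∀ K α β N S Q →
      K * 0ℤ * (N * N) + α * 1ℤ * Q + (α * 0ℤ + β * 1ℤ) * S - (α * 1ℤ + - β * 1ℤ) * S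
      + (β * 0ℤ + - β * 1ℤ) * (N * S) ≡ - (α * (S - Q) + β * ((N - + 2) * S))
    evaluate = solve-∀

  ∑∑W·weight : ∑∑ (λ x y → W c x y * ⟦ weight ⟧ x y) ≡ S * (N * Q - + 2 * S)
  ∑∑W·weight = begin
    ∑∑ (λ x y → W c x y * ⟦ weight ⟧ x y)
      ≡⟨ ∑∑-cong (λ x y → cong (_* ⟦ weight ⟧ x y) (as-form (W c x y) (v x) (v y))) ⟩
    ∑∑ (λ x y → ⟦ lin 0ℤ 1ℤ 0ℤ 0ℤ ⟧ x y * ⟦ weight ⟧ x y)
      ≡⟨ ∑∑-gram (lin 0ℤ 1ℤ 0ℤ 0ℤ) weight ⟩
    gram (lin 0ℤ 1ℤ 0ℤ 0ℤ) weight
      ≡⟨ evaluate K α β N S Q ⟩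
    α * Q + + 2 * β * S
      ≡⟨ factor N S Q ⟩
    S * (N * Q - + 2 * S) ∎
    where
    open ≡-Reasoning
    as-form : ∀ w a b → w ≡ 0ℤ + 1ℤ * w + 0ℤ * a + 0ℤ * b
    as-form = solve-∀
    evaluate : ∀ K α β N S Q →
      0ℤ * K * (N * N) + 1ℤ * α * Q + (1ℤ * β + 0ℤ * α) * S - (1ℤ * - β + 0ℤ * α) * S
      + (0ℤ * β + 0ℤ * - β) * (N * S) ≡ α * Q + + 2 * β * S
    evaluate = solve-∀
    factor : ∀ N S Q → (N - + 2) * S * Q + + 2 * (Q - S) * S ≡ S * (N * Q - + 2 * S)
    factor = solve-∀

  -- For a chaotic c both factors are nonzero: S = 0 would make c balanced, and
  -- N Q = 2 S would make it partisan.
  chaotic⇒∑∑W·weight≢0 : Chaotic c → ∑∑ (λ x y → W c x y * ⟦ weight ⟧ x y) ≢ 0ℤ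
  chaotic⇒∑∑W·weight≢0 (imbalanced , not-partisan) ∑∑≡0 =
    by-factor (i*j≡0⇒i≡0∨j≡0 S (trans (sym ∑∑W·weight) ∑∑≡0)) (imbalanced⇒W≡1 imbalanced)
    where
    by-factor : S ≡ 0ℤ ⊎ N * Q - + 2 * S ≡ 0ℤ → ∃ (λ p → ∃ λ q → W c p q ≡ 1ℤ) → ⊥
    by-factor (inj₁ S≡0)   _                 = imbalanced (S≡0⇒balanced S≡0)
    by-factor (inj₂ NQ≡2S) (p , q , Wpq≡1)   =
      not-partisan (additive⇒partisan (N·Q≡2·S⇒additive NQ≡2S p) p q Wpq≡1)

mainTheorem11 : (n : ℕ) → n ≥ 3 → (c : PartialChoice n) →
    Chaotic c → ValenceImbalanced c
mainTheorem11 n _ c chaotic =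
  pair-weights⇒valence-imbalanced c (⟦_⟧ c (weight c)) (weight≥0 c)
    (drop-diagonal c (λ x y → v c x - W c x y) first-diagonal (first-coordinates c))
    (drop-diagonal c (λ x y → v c y + W c x y) second-diagonal (second-coordinates c))
    (chaotic⇒∑∑W·weight≢0 c chaotic)
  where
  first-diagonal : ∀ x → v c x - W c x x ≡ v c x
  first-diagonal x = trans (cong (λ w → v c x - w) (W-diag c x)) (+-identityʳ (v c x))
  second-diagonal : ∀ x → v c x + W c x x ≡ v c x
  second-diagonal x = trans (cong (λ w → v c x + w) (W-diag c x)) (+-identityʳ (v c x))
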